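{- Let $k\ge 2$ and $n\ge 1$ be integers. The minimum semisymmetric height of a $k$-dimensional balanced ballot path of length $kn$ is $\left\lceil \frac{k}{2}\right\rceil \left\lfloor \frac{k}{2}\right\rfloor$.
   Context: A $k$-dimensional balanced ballot path of length $kn$ is a sequence $P=(\vec s_1,\dots,\vec s_{kn})$ of standard unit vectors of $\mathbb{R}^k$ in which each $\vec e_i$ ($1\le i\le k$) occurs exactly $n$ times, and such that every intermediate point $\vec v_i=\sum_{j=1}^i \vec s_j$ ($0\le i\le kn$), written $\vec x=(x_1,\dots,x_k)$, satisfies $x_1\ge x_2\ge\cdots\ge x_k$. The semisymmetric height of a point $\vec x\in\mathbb{Z}_{\ge0}^k$ is $g_k(\vec x)=\sum_{i=1}^k (k+1-2i)x_i$, and the semisymmetric height $g_k(P)$ of a path $P$ is the maximum of $g_k(\vec v_i)$ over all its intermediate points $\vec v_0,\dots,\vec v_{kn}$. -}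

module Defs where

open import Data.Nat using (ℕ; zero; suc; _*_; ⌈_/2⌉; ⌊_/2⌋) renaming (_+_ to _+ℕ_; _≤_ to _≤ℕ_)
open import Data.Integer using (ℤ; +_; _-_; _⊔_) renaming (_+_ to _+ℤ_; _*_ to _*ℤ_; _≤_ to _≤ℤ_)
open import Data.Fin using (Fin; toℕ; _≟_) renaming (_≤_ to _≤F_)
open import Data.List using (List; []; map; foldr; filter; length; inits; allFin)
open import Data.List.Relation.Unary.All using (All)
open import Data.Product using (Σ; _×_)

-- A lattice point of ℤ^k_{≥0}, coordinates indexed by Fin k (coordinate i+1 of the paper is index i).
Point : ℕ → Set
Point k = Fin k → ℕ

-- A path is its list of steps; step j stands for the unit vector e_{j+1}.
Path : ℕ → Set
Path k = List (Fin k)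

count : {k : ℕ} → Fin k → List (Fin k) → ℕ
count j ws = length (filter (_≟ j) ws)

endpoint : {k : ℕ} → List (Fin k) → Point k
endpoint ws j = count j ws

points : {k : ℕ} → Path k → List (Point k)
points P = map endpoint (inits P)

Balanced : (k n : ℕ) → Path k → Set
Balanced k n P = (i : Fin k) → count i P ≡ℕ n
  where open import Relation.Binary.PropositionalEquality renaming (_≡_ to _≡ℕ_)

Ballot : (k : ℕ) → Path k → Set
Ballot k P = All (λ v → (i j : Fin k) → i ≤F j → v j ≤ℕ v i) (points P)

sumℤ : List ℤ → ℤ
sumℤ = foldr _+ℤ_ (+ 0)

-- g_k(x) = Σ_{i=1}^k (k+1-2i) x_i   (paper index i = toℕ i' + 1)
g : (k : ℕ) → Point k → ℤ
g k x = sumℤ (map (λ i → ((+ (k +ℕ 1)) - (+ (2 * suc (toℕ i)))) *ℤ (+ x i)) (allFin k))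

-- g_k(P) = max over v_0,...,v_{kn} of g_k(v_i)  (v_0 = origin is always among them).
height : (k : ℕ) → Path k → ℤ
height k P = foldr _⊔_ (g k (endpoint [])) (map (g k) (points P))

IsBBP : (k n : ℕ) → Path k → Set
IsBBP k n P = Balanced k n P × Ballot k P

{-# OPTIONS --safe #-}
-- Let a = ⌈k/2⌉.  Stop a balanced ballot path just before its first step e_i with i > a.
-- The ballot condition at the following point forces each of x_1, …, x_a to be at least 1
-- already, while x_{a+1}, …, x_k are still 0.  The coefficients k+1-2i of x_1, …, x_a are
-- nonnegative, so the height there is at least g_k(1,…,1,0,…,0) = a(k-a) = ⌈k/2⌉⌊k/2⌋.
-- Conversely, the round-robin path (e_1 e_2 ⋯ e_k)^n visits only the points
-- t(1,…,1) + (1,…,1,0,…,0) with b ones.  The partial sums of the coefficients telescope to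
-- b(k-b), and the full sum vanishes, so these points have height b(k-b) ≤ ⌈k/2⌉⌊k/2⌋.
module Submission where

open import Defs
open import Data.Nat using (ℕ; _*_; _≤_; ⌈_/2⌉; ⌊_/2⌋)
open import Data.Integer using (+_) renaming (_≤_ to _≤ℤ_)
open import Data.Product using (Σ; _×_)
open import Relation.Binary.PropositionalEquality using (_≡_)

open import Data.Nat using (zero; suc; _+_; _∸_; _<_; z≤n; s≤s; _<?_)
import Data.Nat.Properties as ℕ
open import Data.Integer using (ℤ; 0ℤ; +≤+; _-_) renaming (_+_ to _+ℤ_; _*_ to _*ℤ_; _⊔_ to _⊔ℤ_)
import Data.Integer.Properties as ℤ
open import Data.Integer.Tactic.RingSolver using (solve-∀)
open import Data.Fin using (Fin; zero; suc; toℕ; fromℕ<; _≟_) renaming (_≤_ to _≤F_)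
open import Data.Fin.Properties using (toℕ-fromℕ<)
open import Data.List
  using (List; []; _∷_; _++_; [_]; map; filter; length; inits; allFin; tabulate; concat; replicate)
import Data.List.Properties as List
open import Data.List.Relation.Unary.All using (All; []; _∷_)
import Data.List.Relation.Unary.All as All
import Data.List.Relation.Unary.All.Properties as All
import Data.List.Relation.Unary.Any as Any
open import Data.List.Relation.Unary.Any using (here; there)
import Data.List.Relation.Unary.First as First
open import Data.List.Relation.Unary.First using (FirstView; first)
open import Data.List.Relation.Unary.First.Properties using (toView)
open import Data.List.Membership.Propositional using (_∈_)
open import Data.List.Membership.Propositional.Properties using (∈-map⁺)
open import Data.Product using (∃; ∃₂; _,_)
open import Data.Sum using (inj₁; inj₂; [_,_]′; swap)
open import Function using (id; _∘_)
open import Relation.Binary.PropositionalEquality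
  using (_≢_; _≗_; refl; sym; trans; cong; cong₂; subst; subst₂; module ≡-Reasoning)
open import Relation.Nullary using (yes; no; contradiction)

count-accept : ∀ {k} (j : Fin k) ws → count j (j ∷ ws) ≡ suc (count j ws)
count-accept j ws = cong length (List.filter-accept (_≟ j) refl)

count-reject : ∀ {k} {x j : Fin k} ws → x ≢ j → count j (x ∷ ws) ≡ count j ws
count-reject ws x≢j = cong length (List.filter-reject (_≟ _) x≢j)

count-++ : ∀ {k} (j : Fin k) xs ys → count j (xs ++ ys) ≡ count j xs + count j ys
count-++ j xs ys =
  trans (cong length (List.filter-++ (_≟ j) xs ys)) (List.length-++ (filter (_≟ j) xs))

count-none : ∀ {k} {j : Fin k} {ws} → All (_≢ j) ws → count j ws ≡ 0
count-none ws≢j = cong length (List.filter-none (_≟ _) ws≢j)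

count-zero-map-suc : ∀ {k} (ws : List (Fin k)) → count zero (map suc ws) ≡ 0
count-zero-map-suc ws = count-none (All.map⁺ (All.universal (λ _ ()) ws))

count-suc-map-suc : ∀ {k} (i : Fin k) ws → count (suc i) (map suc ws) ≡ count i ws
count-suc-map-suc i [] = refl
-- suc x ≟ suc i computes to x ≟ i, so one test unfolds the filters on both sides.
count-suc-map-suc i (x ∷ ws) with x ≟ i
... | yes refl = cong suc (count-suc-map-suc x ws)
... | no _     = count-suc-map-suc i ws

allFin-suc : ∀ k → allFin (suc k) ≡ zero ∷ map suc (allFin k)
allFin-suc k = cong (zero ∷_) (sym (List.map-tabulate id suc))

count-allFin : ∀ {k} (i : Fin k) → count i (allFin k) ≡ 1
count-allFin {suc k} zero    = trans (cong (count zero) (allFin-suc k))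
                                     (cong suc (count-zero-map-suc (allFin k)))
count-allFin {suc k} (suc i) = trans (cong (count (suc i)) (allFin-suc k))
                                     (trans (count-suc-map-suc i (allFin k)) (count-allFin i))

∈-inits-++ : ∀ {A : Set} (xs ys : List A) → xs ∈ inits (xs ++ ys)
∈-inits-++ []       ys = here refl
∈-inits-++ (x ∷ xs) ys = there (∈-map⁺ (x ∷_) (∈-inits-++ xs ys))

All-inits-++ : ∀ {A : Set} {P : List A → Set} xs {ys} →
               All P (inits xs) → All (P ∘ (xs ++_)) (inits ys) → All P (inits (xs ++ ys))
All-inits-++ []       _          pys = pys
All-inits-++ (x ∷ xs) (p[] ∷ ps) pys = p[] ∷ All.map⁺ (All-inits-++ xs (All.map⁻ ps) pys)

All-inits-map⁺ : ∀ {A B : Set} {P : List B → Set} (f : A → B) xs →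
                 All (P ∘ map f) (inits xs) → All P (inits (map f xs))
All-inits-map⁺ f []       (p ∷ []) = p ∷ []
All-inits-map⁺ f (x ∷ xs) (p ∷ ps) = p ∷ All.map⁺ (All-inits-map⁺ f xs (All.map⁻ ps))

height-≥ : ∀ {k} {P : Path k} {v} → v ∈ points P → g k v ≤ℤ height k P
height-≥ {k} {v = v} v∈P = List.foldr-preservesᵒ {P = g k v ≤ℤ_} {f = _⊔ℤ_}
  (λ x y → [ (λ le → ℤ.≤-trans le (ℤ.i≤i⊔j x y)) , (λ le → ℤ.≤-trans le (ℤ.i≤j⊔i x y)) ]′)
  _ _ (inj₂ (Any.map ℤ.≤-reflexive (∈-map⁺ (g k) v∈P)))

height-≤ : ∀ {k} {P : Path k} {h} → All (λ v → g k v ≤ℤ h) (points P) → height k P ≤ℤ h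
height-≤ {h = h} below =
  List.foldr-preservesᵇ {P = _≤ℤ h} {f = _⊔ℤ_} ℤ.⊔-lub (All.head below) (All.map⁺ below)

Σ< : ℕ → (ℕ → ℤ) → ℤ
Σ< zero    f = 0ℤ
Σ< (suc m) f = f 0 +ℤ Σ< m (f ∘ suc)

sumℤ-allFin : ∀ m (f : ℕ → ℤ) → sumℤ (map (f ∘ toℕ) (allFin m)) ≡ Σ< m f
sumℤ-allFin m f = trans (cong sumℤ (List.map-tabulate {n = m} id (f ∘ toℕ))) (sumℤ-tabulate m f)
  where
  sumℤ-tabulate : ∀ m (f : ℕ → ℤ) → sumℤ (tabulate {n = m} (f ∘ toℕ)) ≡ Σ< m f
  sumℤ-tabulate zero    f = refl
  sumℤ-tabulate (suc m) f = cong (f 0 +ℤ_) (sumℤ-tabulate m (f ∘ suc))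

Σ<-cong : ∀ m {f h : ℕ → ℤ} → f ≗ h → Σ< m f ≡ Σ< m h
Σ<-cong zero    f≗h = refl
Σ<-cong (suc m) f≗h = cong₂ _+ℤ_ (f≗h 0) (Σ<-cong m (f≗h ∘ suc))

Σ<-+ : ∀ m (f h : ℕ → ℤ) → Σ< m (λ i → f i +ℤ h i) ≡ Σ< m f +ℤ Σ< m h
Σ<-+ zero    f h = refl
Σ<-+ (suc m) f h = trans (cong (f 0 +ℤ h 0 +ℤ_) (Σ<-+ m (f ∘ suc) (h ∘ suc)))
                         (interchange (f 0) (h 0) (Σ< m (f ∘ suc)) (Σ< m (h ∘ suc)))
  where
  interchange : ∀ a b c d → a +ℤ b +ℤ (c +ℤ d) ≡ a +ℤ c +ℤ (b +ℤ d)
  interchange = solve-∀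

Σ<-*ʳ : ∀ m (f : ℕ → ℤ) c → Σ< m (λ i → f i *ℤ c) ≡ Σ< m f *ℤ c
Σ<-*ʳ zero    f c = sym (ℤ.*-zeroˡ c)
Σ<-*ʳ (suc m) f c = trans (cong (f 0 *ℤ c +ℤ_) (Σ<-*ʳ m (f ∘ suc) c))
                          (sym (ℤ.*-distribʳ-+ c (f 0) (Σ< m (f ∘ suc))))

Σ<-telescope : ∀ m (F : ℕ → ℤ) → Σ< m (λ i → F (suc i) - F i) ≡ F m - F 0
Σ<-telescope zero    F = sym (ℤ.+-inverseʳ (F 0))
Σ<-telescope (suc m) F = trans (cong (F 1 - F 0 +ℤ_) (Σ<-telescope m (F ∘ suc)))
                               (cancel (F 0) (F 1) (F (suc m)))
  where
  cancel : ∀ a b c → b - a +ℤ (c - b) ≡ c - a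
  cancel = solve-∀

χ : ℕ → ℕ → ℕ
χ zero    i       = 0
χ (suc b) zero    = 1
χ (suc b) (suc i) = χ b i

χ-< : ∀ {b i} → i < b → χ b i ≡ 1
χ-< {suc b} {zero}  _           = refl
χ-< {suc b} {suc i} (s≤s i<b) = χ-< i<b

χ-≥ : ∀ {b i} → b ≤ i → χ b i ≡ 0
χ-≥ {zero}              _           = refl
χ-≥ {suc b} {suc i} (s≤s b≤i) = χ-≥ b≤i

χ≤1 : ∀ b i → χ b i ≤ 1
χ≤1 zero    i       = z≤n
χ≤1 (suc b) zero    = ℕ.≤-refl
χ≤1 (suc b) (suc i) = χ≤1 b i

χ-antitone : ∀ b {i j} → i ≤ j → χ b j ≤ χ b i
χ-antitone zero    _                     = z≤n
χ-antitone (suc b) {zero}  {j}     _           = χ≤1 (suc b) j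
χ-antitone (suc b) {suc i} {suc j} (s≤s i≤j) = χ-antitone b i≤j

Σ<-χ : ∀ {m b} (f : ℕ → ℤ) → b ≤ m → Σ< m (λ i → f i *ℤ + χ b i) ≡ Σ< b f
Σ<-χ {m} {zero}  f _           = trans (Σ<-*ʳ m f 0ℤ) (ℤ.*-zeroʳ (Σ< m f))
Σ<-χ {suc m} {suc b} f (s≤s b≤m) = cong₂ _+ℤ_ (ℤ.*-identityʳ (f 0)) (Σ<-χ (f ∘ suc) b≤m)

-- Verbatim the coefficient inside g, so g k v is definitionally
-- sumℤ (map (λ i → coefficient k (toℕ i) *ℤ + v i) (allFin k)).
coefficient : ℕ → ℕ → ℤ
coefficient k i = + (k + 1) - + (2 * suc i)

coefficient-telescopes : ∀ k i →
  coefficient k i ≡ + suc i *ℤ (+ k - + suc i) - + i *ℤ (+ k - + i)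
coefficient-telescopes k i =
  trans (cong₂ _-_ (ℤ.pos-+ k 1) (ℤ.pos-* 2 (suc i))) (identity (+ k) (+ i))
  where
  identity : ∀ K I → K +ℤ + 1 - + 2 *ℤ (+ 1 +ℤ I)
                   ≡ (+ 1 +ℤ I) *ℤ (K - (+ 1 +ℤ I)) - I *ℤ (K - I)
  identity = solve-∀

Σ<-coefficient : ∀ {k b} → b ≤ k → Σ< b (coefficient k) ≡ + (b * (k ∸ b))
Σ<-coefficient {k} {b} b≤k = begin
  Σ< b (coefficient k)               ≡⟨ Σ<-cong b (coefficient-telescopes k) ⟩
  Σ< b (λ i → F (suc i) - F i)       ≡⟨ Σ<-telescope b F ⟩
  F b - 0ℤ                           ≡⟨ ℤ.+-identityʳ (F b) ⟩
  + b *ℤ (+ k - + b)                 ≡⟨ cong (+ b *ℤ_) (trans (ℤ.m-n≡m⊖n k b) (ℤ.⊖-≥ b≤k)) ⟩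
  + b *ℤ + (k ∸ b)                   ≡⟨ ℤ.pos-* b (k ∸ b) ⟨
  + (b * (k ∸ b))                    ∎
  where
  open ≡-Reasoning
  F : ℕ → ℤ
  F i = + i *ℤ (+ k - + i)

level : ∀ {k} → ℕ → ℕ → Point k
level t b j = t + χ b (toℕ j)

g-level : ∀ {k} t {b} → b ≤ k → g k (level t b) ≡ + (b * (k ∸ b))
g-level {k} t {b} b≤k = begin
  g k (level t b)
    ≡⟨ sumℤ-allFin k (λ i → c i *ℤ + (t + χ b i)) ⟩
  Σ< k (λ i → c i *ℤ + (t + χ b i))
    ≡⟨ Σ<-cong k (λ i → trans (cong (c i *ℤ_) (ℤ.pos-+ t (χ b i))) (ℤ.*-distribˡ-+ (c i) (+ t) _)) ⟩
  Σ< k (λ i → c i *ℤ + t +ℤ c i *ℤ + χ b i)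
    ≡⟨ Σ<-+ k (λ i → c i *ℤ + t) (λ i → c i *ℤ + χ b i) ⟩
  Σ< k (λ i → c i *ℤ + t) +ℤ Σ< k (λ i → c i *ℤ + χ b i)
    ≡⟨ cong₂ _+ℤ_ (Σ<-*ʳ k c (+ t)) (Σ<-χ c b≤k) ⟩
  Σ< k c *ℤ + t +ℤ Σ< b c
    ≡⟨ cong₂ (λ x y → x *ℤ + t +ℤ y) (trans (Σ<-coefficient {k} ℕ.≤-refl) full-round)
                                    (Σ<-coefficient b≤k) ⟩
  + (b * (k ∸ b))
    ∎
  where
  open ≡-Reasoning
  c : ℕ → ℤ
  c = coefficient k
  full-round : + (k * (k ∸ k)) ≡ 0ℤ
  full-round = cong +_ (trans (cong (k *_) (ℕ.n∸n≡0 k)) (ℕ.*-zeroʳ k))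

g-cong : ∀ {k} {v w : Point k} → v ≗ w → g k v ≡ g k w
g-cong {k} v≗w =
  cong sumℤ (List.map-cong (λ i → cong (λ z → coefficient k (toℕ i) *ℤ + z) (v≗w i)) (allFin k))

sumℤ-map-mono : ∀ {A : Set} {f h : A → ℤ} → (∀ x → f x ≤ℤ h x) →
                ∀ xs → sumℤ (map f xs) ≤ℤ sumℤ (map h xs)
sumℤ-map-mono f≤h []       = ℤ.≤-refl
sumℤ-map-mono f≤h (x ∷ xs) = ℤ.+-mono-≤ (f≤h x) (sumℤ-map-mono f≤h xs)

g-mono : ∀ {k} {v w : Point k} →
         (∀ j → coefficient k (toℕ j) *ℤ + v j ≤ℤ coefficient k (toℕ j) *ℤ + w j) → g k v ≤ℤ g k w
g-mono {k} termwise = sumℤ-map-mono termwise (allFin k)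

*-≤-balanced : ∀ {b r p q} → b ≤ q → q ≤ p → b + r ≡ q + p → b * r ≤ q * p
*-≤-balanced {b} {r} {p} {q} b≤q q≤p b+r≡q+p with ℕ.m≤n⇒∃[o]m+o≡n b≤q
... | e , refl = begin
  b * r          ≡⟨ cong (b *_) r≡e+p ⟩
  b * (e + p)    ≡⟨ ℕ.*-distribˡ-+ b e p ⟩
  b * e + b * p  ≤⟨ ℕ.+-monoˡ-≤ (b * p) (ℕ.*-monoˡ-≤ e (ℕ.≤-trans b≤q q≤p)) ⟩
  p * e + b * p  ≡⟨ ℕ.+-comm (p * e) (b * p) ⟩
  b * p + p * e  ≡⟨ cong (_+_ (b * p)) (ℕ.*-comm p e) ⟩
  b * p + e * p  ≡⟨ ℕ.*-distribʳ-+ p b e ⟨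
  (b + e) * p    ∎
  where
  open ℕ.≤-Reasoning
  r≡e+p : r ≡ e + p
  r≡e+p = ℕ.+-cancelˡ-≡ b r (e + p) (trans b+r≡q+p (ℕ.+-assoc b e p))

⌈n/2⌉≤1+⌊n/2⌋ : ∀ n → ⌈ n /2⌉ ≤ suc ⌊ n /2⌋
⌈n/2⌉≤1+⌊n/2⌋ zero          = z≤n
⌈n/2⌉≤1+⌊n/2⌋ (suc zero)    = s≤s z≤n
⌈n/2⌉≤1+⌊n/2⌋ (suc (suc n)) = s≤s (⌈n/2⌉≤1+⌊n/2⌋ n)

2*⌈n/2⌉≤1+n : ∀ n → 2 * ⌈ n /2⌉ ≤ suc n
2*⌈n/2⌉≤1+n zero          = z≤n
2*⌈n/2⌉≤1+n (suc zero)    = ℕ.≤-refl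
2*⌈n/2⌉≤1+n (suc (suc n)) =
  subst (_≤ 3 + n) (sym (ℕ.*-suc 2 ⌈ n /2⌉)) (s≤s (s≤s (2*⌈n/2⌉≤1+n n)))

2≤n⇒⌈n/2⌉<n : ∀ {n} → 2 ≤ n → ⌈ n /2⌉ < n
2≤n⇒⌈n/2⌉<n {suc (suc n)} _ = ℕ.⌈n/2⌉<n n
2≤n⇒⌈n/2⌉<n {suc zero} (s≤s ())

n∸⌈n/2⌉≡⌊n/2⌋ : ∀ n → n ∸ ⌈ n /2⌉ ≡ ⌊ n /2⌋
n∸⌈n/2⌉≡⌊n/2⌋ n = trans (cong (_∸ ⌈ n /2⌉) (sym (ℕ.⌊n/2⌋+⌈n/2⌉≡n n))) (ℕ.m+n∸n≡m ⌊ n /2⌋ ⌈ n /2⌉)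

b*[k∸b]≤⌈k/2⌉*⌊k/2⌋ : ∀ {k b} → b ≤ k → b * (k ∸ b) ≤ ⌈ k /2⌉ * ⌊ k /2⌋
b*[k∸b]≤⌈k/2⌉*⌊k/2⌋ {k} {b} b≤k = [ lowerHalf , upperHalf ]′ (ℕ.≤-<-connex b ⌊ k /2⌋)
  where
  q≤p : ⌊ k /2⌋ ≤ ⌈ k /2⌉
  q≤p = ℕ.⌊n/2⌋≤⌈n/2⌉ k
  k≡q+p : k ≡ ⌊ k /2⌋ + ⌈ k /2⌉
  k≡q+p = sym (ℕ.⌊n/2⌋+⌈n/2⌉≡n k)
  lowerHalf : b ≤ ⌊ k /2⌋ → b * (k ∸ b) ≤ ⌈ k /2⌉ * ⌊ k /2⌋
  lowerHalf b≤q = subst (b * (k ∸ b) ≤_) (ℕ.*-comm ⌊ k /2⌋ ⌈ k /2⌉)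
                    (*-≤-balanced b≤q q≤p (trans (ℕ.m+[n∸m]≡n b≤k) k≡q+p))
  upperHalf : ⌊ k /2⌋ < b → b * (k ∸ b) ≤ ⌈ k /2⌉ * ⌊ k /2⌋
  upperHalf q<b = subst₂ _≤_ (ℕ.*-comm (k ∸ b) b) (ℕ.*-comm ⌊ k /2⌋ ⌈ k /2⌉)
                    (*-≤-balanced r≤q q≤p (trans (ℕ.m∸n+n≡m b≤k) k≡q+p))
    where
    r≤q : k ∸ b ≤ ⌊ k /2⌋
    r≤q = ℕ.≤-trans (ℕ.∸-monoʳ-≤ k (ℕ.≤-trans (⌈n/2⌉≤1+⌊n/2⌋ k) q<b))
                    (ℕ.≤-reflexive (n∸⌈n/2⌉≡⌊n/2⌋ k))

IsBallotPoint : ∀ {k} → Point k → Set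
IsBallotPoint {k} v = (i j : Fin k) → i ≤F j → v j ≤ v i

IsLevel : ∀ {k} → Point k → Set
IsLevel {k} v = ∃₂ λ t b → b ≤ k × v ≗ level t b

IsLevel⇒IsBallotPoint : ∀ {k} {v : Point k} → IsLevel v → IsBallotPoint v
IsLevel⇒IsBallotPoint (t , b , _ , v≗level) i j i≤j =
  subst₂ _≤_ (sym (v≗level j)) (sym (v≗level i)) (ℕ.+-monoʳ-≤ t (χ-antitone b i≤j))

IsLevel⇒g≤⌈k/2⌉*⌊k/2⌋ : ∀ {k} {v : Point k} → IsLevel v → g k v ≤ℤ + (⌈ k /2⌉ * ⌊ k /2⌋)
IsLevel⇒g≤⌈k/2⌉*⌊k/2⌋ {k} (t , b , b≤k , v≗level) =
  subst (_≤ℤ + (⌈ k /2⌉ * ⌊ k /2⌋)) (sym (trans (g-cong v≗level) (g-level t b≤k)))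
        (+≤+ (b*[k∸b]≤⌈k/2⌉*⌊k/2⌋ b≤k))

roundRobin : (k n : ℕ) → Path k
roundRobin k n = concat (replicate n (allFin k))

roundRobin-balanced : ∀ k n → Balanced k n (roundRobin k n)
roundRobin-balanced k zero    i = refl
roundRobin-balanced k (suc n) i =
  trans (count-++ i (allFin k) (roundRobin k n))
        (cong₂ _+_ (count-allFin i) (roundRobin-balanced k n i))

inits-allFin-level : ∀ k → All (λ vs → ∃ λ b → b ≤ k × endpoint vs ≗ level 0 b) (inits (allFin k))
inits-allFin-level zero    = (0 , z≤n , λ ()) ∷ []
inits-allFin-level (suc k) =
  subst (λ ws → All Q (inits ws)) (sym (allFin-suc k))
        ((0 , z≤n , λ _ → refl) ∷
         All.map⁺ (All-inits-map⁺ suc (allFin k) (All.map shift (inits-allFin-level k))))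
  where
  Q : List (Fin (suc k)) → Set
  Q vs = ∃ λ b → b ≤ suc k × endpoint vs ≗ level 0 b
  shift : ∀ {vs} → (∃ λ b → b ≤ k × endpoint vs ≗ level 0 b) → Q (zero ∷ map suc vs)
  shift {vs} (b , b≤k , vs≗level) = suc b , s≤s b≤k , λ where
    zero    → cong suc (count-zero-map-suc vs)
    (suc j) → trans (count-suc-map-suc j vs) (vs≗level j)

points-roundRobin : ∀ k n → All IsLevel (points (roundRobin k n))
points-roundRobin k n = All.map⁺ (prefixes n)
  where
  prefixes : ∀ n → All (IsLevel ∘ endpoint) (inits (roundRobin k n))
  prefixes zero    = (0 , 0 , z≤n , λ _ → refl) ∷ []
  prefixes (suc n) = All-inits-++ (allFin k)
    (All.map (0 ,_) (inits-allFin-level k))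
    (All.map nextRound (prefixes n))
    where
    nextRound : ∀ {vs} → IsLevel (endpoint vs) → IsLevel (endpoint (allFin k ++ vs))
    nextRound {vs} (t , b , b≤k , vs≗level) = suc t , b , b≤k , λ j →
      trans (count-++ j (allFin k) vs) (cong₂ _+_ (count-allFin j) (vs≗level j))

roundRobin-isBBP : ∀ k n → IsBBP k n (roundRobin k n)
roundRobin-isBBP k n =
  roundRobin-balanced k n , All.map IsLevel⇒IsBallotPoint (points-roundRobin k n)

height-roundRobin : ∀ k n → height k (roundRobin k n) ≤ℤ + (⌈ k /2⌉ * ⌊ k /2⌋)
height-roundRobin k n = height-≤ (All.map IsLevel⇒g≤⌈k/2⌉*⌊k/2⌋ (points-roundRobin k n))

firstStep≥ : ∀ {k} a (P : Path k) (j : Fin k) → a ≤ toℕ j → 1 ≤ count j P →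
                FirstView (λ x → toℕ x < a) (λ x → a ≤ toℕ x) P
firstStep≥ a P j a≤j 1≤count with first (λ x → swap (ℕ.≤-<-connex a (toℕ x))) P
... | inj₁ found    = toView found
... | inj₂ allBelow = contradiction (subst (1 ≤_) (count-none (All.map ≢j allBelow)) 1≤count) λ ()
  where
  ≢j : ∀ {x} → toℕ x < a → x ≢ j
  ≢j x<a refl = ℕ.<⇒≱ x<a a≤j

ballot-before-step : ∀ {k} xs (s j : Fin k) → IsBallotPoint (endpoint (xs ++ [ s ])) →
                     toℕ j < toℕ s → 1 ≤ count j xs
ballot-before-step xs s j ballot j<s = begin
  1                           ≤⟨ ℕ.m≤n+m 1 (count s xs) ⟩
  count s xs + 1              ≡⟨ cong (_+_ (count s xs)) (count-accept s []) ⟨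
  count s xs + count s [ s ]  ≡⟨ count-++ s xs [ s ] ⟨
  count s (xs ++ [ s ])       ≤⟨ ballot j s (ℕ.<⇒≤ j<s) ⟩
  count j (xs ++ [ s ])       ≡⟨ count-++ j xs [ s ] ⟩
  count j xs + count j [ s ]  ≡⟨ cong (_+_ (count j xs)) (count-reject [] s≢j) ⟩
  count j xs + 0              ≡⟨ ℕ.+-identityʳ (count j xs) ⟩
  count j xs                  ∎
  where
  open ℕ.≤-Reasoning
  s≢j : s ≢ j
  s≢j refl = ℕ.<-irrefl refl j<s

coefficient-nonNeg : ∀ {k i} → 2 * suc i ≤ suc k → coefficient k i ≡ + (suc k ∸ 2 * suc i)
coefficient-nonNeg {k} {i} le =
  trans (cong (λ m → + m - + (2 * suc i)) (ℕ.+-comm k 1))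
        (trans (ℤ.m-n≡m⊖n (suc k) (2 * suc i)) (ℤ.⊖-≥ le))

g-level≤g : ∀ {k a} (u : Point k) → 2 * a ≤ suc k →
            (∀ j → toℕ j < a → 1 ≤ u j) → (∀ j → a ≤ toℕ j → u j ≡ 0) → g k (level 0 a) ≤ℤ g k u
g-level≤g {k} {a} u 2a≤1+k covered unvisited = g-mono termwise
  where
  termwise : ∀ j → coefficient k (toℕ j) *ℤ + χ a (toℕ j) ≤ℤ coefficient k (toℕ j) *ℤ + u j
  termwise j with toℕ j <? a
  ... | yes j<a = subst (λ c → c *ℤ + χ a (toℕ j) ≤ℤ c *ℤ + u j)
                    (sym (coefficient-nonNeg (ℕ.≤-trans (ℕ.*-monoʳ-≤ 2 j<a) 2a≤1+k)))
                    (ℤ.*-monoˡ-≤-nonNeg (+ (suc k ∸ 2 * suc (toℕ j)))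
                      (+≤+ (subst (_≤ u j) (sym (χ-< j<a)) (covered j j<a))))
  ... | no  j≮a = ℤ.≤-reflexive (cong (λ z → coefficient k (toℕ j) *ℤ + z)
                    (trans (χ-≥ (ℕ.≮⇒≥ j≮a)) (sym (unvisited j (ℕ.≮⇒≥ j≮a)))))

a*[k∸a]≤height : ∀ {k n a} (P : Path k) → IsBBP k n P → 1 ≤ n → a < k → 2 * a ≤ suc k →
                 + (a * (k ∸ a)) ≤ℤ height k P
a*[k∸a]≤height {k} {a = a} P (balanced , ballot) 1≤n a<k 2a≤1+k
  with firstStep≥ a P (fromℕ< a<k) (ℕ.≤-reflexive (sym (toℕ-fromℕ< a<k)))
                     (subst (1 ≤_) (sym (balanced _)) 1≤n)
... | First._++_∷_ {xs} {s} below a≤s ys = begin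
  + (a * (k ∸ a))         ≡⟨ g-level 0 (ℕ.<⇒≤ a<k) ⟨
  g k (level 0 a)         ≤⟨ g-level≤g (endpoint xs) 2a≤1+k covered unvisited ⟩
  g k (endpoint xs)       ≤⟨ height-≥ (∈-map⁺ endpoint (∈-inits-++ xs (s ∷ ys))) ⟩
  height k (xs ++ s ∷ ys) ∎
  where
  open ℤ.≤-Reasoning
  xs∷s∈ : xs ++ [ s ] ∈ inits (xs ++ s ∷ ys)
  xs∷s∈ = subst (λ ws → xs ++ [ s ] ∈ inits ws) (List.++-assoc xs [ s ] ys)
                (∈-inits-++ (xs ++ [ s ]) ys)
  covered : ∀ j → toℕ j < a → 1 ≤ endpoint xs j
  covered j j<a =
    ballot-before-step xs s j (All.lookup ballot (∈-map⁺ endpoint xs∷s∈)) (ℕ.<-≤-trans j<a a≤s)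
  unvisited : ∀ j → a ≤ toℕ j → endpoint xs j ≡ 0
  unvisited j a≤j = count-none (All.map (λ { x<a refl → ℕ.<⇒≱ x<a a≤j }) below)

proposition2p23 : (k n : ℕ) → 2 ≤ k → 1 ≤ n →
    (Σ (Path k) (λ P → IsBBP k n P × height k P ≡ + (⌈ k /2⌉ * ⌊ k /2⌋)))
    × ((P : Path k) → IsBBP k n P → + (⌈ k /2⌉ * ⌊ k /2⌋) ≤ℤ height k P)
proposition2p23 k n 2≤k 1≤n =
  (roundRobin k n , roundRobin-isBBP k n ,
   ℤ.≤-antisym (height-roundRobin k n) (lowerBound (roundRobin k n) (roundRobin-isBBP k n))) ,
  lowerBound
  where
  lowerBound : (P : Path k) → IsBBP k n P → + (⌈ k /2⌉ * ⌊ k /2⌋) ≤ℤ height k P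
  lowerBound P bbp = subst (λ m → + (⌈ k /2⌉ * m) ≤ℤ height k P) (n∸⌈n/2⌉≡⌊n/2⌋ k)
                           (a*[k∸a]≤height P bbp 1≤n (2≤n⇒⌈n/2⌉<n 2≤k) (2*⌈n/2⌉≤1+n k))
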